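{- Let $r\ge1$, $X=[r]$, and let $U$ be the bipartitional relation associated with an ordered bipartition $((B_1,\dots,B_k),(\beta_1,\dots,\beta_k))$ of $X$; let $b_l=\min B_l$. Let $w=x_1\cdots x_m$ be a word over $X$ and $m_l$ the number of letters of $w$ belonging to $B_l$. Let $w_U=z_1\cdots z_m$ be obtained from $w$ as follows: for each $l$ with $\beta_l=0$, reading $w$ from left to right, the successive letters belonging to $B_l$ are replaced by $(b_l,1),(b_l,2),\dots,(b_l,m_l)$; for each $l$ with $\beta_l=1$, reading $w$ from right to left, the successive letters belonging to $B_l$ are replaced by $(b_l,1),\dots,(b_l,m_l)$. Order these pairs totally by $(b_l,j)>(b_{l'},j')$ iff $l<l'$, or $l=l'$ and $j>j'$. Then $$\mathrm{maj}'_U w=\mathrm{maj}\,w_U,$$ where $\mathrm{maj}\,w_U=\sum_{i=1}^{m-1}i\,\chi(z_i>z_{i+1})$ with respect to this total order.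
   Context: $\mathrm{maj}'_U w=\sum_{i=1}^{m-1}i\,\chi((x_i,x_{i+1})\in U)$, $\chi$ the truth indicator. Ordered bipartition: $(B_1,\dots,B_k)$ non-empty pairwise disjoint with union $X$, plus $(\beta_1,\dots,\beta_k)\in\{0,1\}^k$; associated bipartitional relation: $(x,y)\in U$ iff $x\in B_l,y\in B_{l'}$ with $l<l'$, or $x,y\in B_l$ with $\beta_l=1$. -}

module Defs where

open import Data.Nat using (ℕ; zero; suc; _+_; _*_; _<ᵇ_; _≡ᵇ_)
open import Data.Fin using (Fin; toℕ)
open import Data.Bool using (Bool; true; false; if_then_else_; _∨_; _∧_)
open import Data.List using (List; []; _∷_; _++_; [_])
open import Data.Product using (_×_; _,_)

-- An ordered bipartition ((B_1..B_k),(β_1..β_k)) of X = Fin r is encoded by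
--   blk : Fin r → Fin k   (x ∈ B_l  iff  blk x ≡ l)
--   β   : Fin k → Bool    (β_l = 1  iff  β l ≡ true)
-- Non-emptiness of the blocks is imposed as a hypothesis in the statement.

module _ {r k : ℕ} (blk : Fin r → Fin k) (β : Fin k → Bool) where

  inU : Fin r → Fin r → Bool
  inU x y = (toℕ (blk x) <ᵇ toℕ (blk y))
          ∨ ((toℕ (blk x) ≡ᵇ toℕ (blk y)) ∧ β (blk x))

  countIn : Fin k → List (Fin r) → ℕ
  countIn l [] = 0
  countIn l (x ∷ xs) = (if toℕ (blk x) ≡ᵇ toℕ l then 1 else 0) + countIn l xs

  -- w_U: the letter at a position lying in B_l becomes (b_l, j), where j is
  -- its rank among the letters of B_l counted from the left (β_l = 0) or
  -- from the right (β_l = 1).  'pre' is the already-read prefix of w.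
  wUFrom : (b : Fin k → Fin r) → List (Fin r) → List (Fin r) → List (Fin r × ℕ)
  wUFrom b pre [] = []
  wUFrom b pre (x ∷ rest) =
    (b (blk x) , suc (if β (blk x) then countIn (blk x) rest else countIn (blk x) pre))
    ∷ wUFrom b (pre ++ [ x ]) rest

  wU : (b : Fin k → Fin r) → List (Fin r) → List (Fin r × ℕ)
  wU b w = wUFrom b [] w

  -- strict order on the pairs: (b_l,j) > (b_l',j') iff l < l', or l = l' and j > j'
  -- (the block index of the label b_l is recovered as blk b_l = l)
  _>ᵖ_ : Fin r × ℕ → Fin r × ℕ → Bool
  (x , j) >ᵖ (x' , j') = (toℕ (blk x) <ᵇ toℕ (blk x'))
                       ∨ ((toℕ (blk x) ≡ᵇ toℕ (blk x')) ∧ (j' <ᵇ j))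

majFrom : {A : Set} → (A → A → Bool) → ℕ → List A → ℕ
majFrom R n [] = 0
majFrom R n (a ∷ []) = 0
majFrom R n (a ∷ b ∷ rest) = (if R a b then n else 0) + majFrom R (suc n) (b ∷ rest)

majWith : {A : Set} → (A → A → Bool) → List A → ℕ
majWith R w = majFrom R 1 w

maj'U : {r k : ℕ} → (Fin r → Fin k) → (Fin k → Bool) → List (Fin r) → ℕ
maj'U blk β w = majWith (inU blk β) w

majP : {r k : ℕ} → (Fin r → Fin k) → (Fin k → Bool) → List (Fin r × ℕ) → ℕ
majP blk β z = majWith (_>ᵖ_ blk β) z

{-# OPTIONS --safe #-}
module Submission where

-- Labels compare exactly as the letters they replace.  Across blocks both orders
-- follow the block index, since blk (b l) ≡ l.  Within a block B_l, adjacent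
-- letters x y receive ranks j_x = j_y + 1 when β_l = 1 (ranks counted from the
-- right) and j_y = j_x + 1 when β_l = 0, so (b_l , j_x) > (b_l , j_y) iff β_l = 1
-- iff (x , y) ∈ U.  Hence the two major indices agree term by term.

open import Defs
open import Data.Bool using (Bool; true; false; T; if_then_else_; _∨_; _∧_)
open import Data.Fin using (Fin; toℕ) renaming (_≤_ to _≤ᶠ_)
open import Data.Fin.Properties using (toℕ-injective)
open import Data.List using (List; []; _∷_; _++_; [_])
open import Data.Nat using (ℕ; _≤_; zero; suc; _+_; _<ᵇ_; _≡ᵇ_)
open import Data.Nat.Properties using (≡ᵇ⇒≡; +-comm)
open import Data.Product using (_,_)
open import Relation.Binary.PropositionalEquality
  using (_≡_; refl; sym; trans; cong; cong₂; module ≡-Reasoning)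

≡ᵇ-refl : ∀ n → (n ≡ᵇ n) ≡ true
≡ᵇ-refl zero    = refl
≡ᵇ-refl (suc n) = ≡ᵇ-refl n

n<ᵇ1+n : ∀ n → (n <ᵇ suc n) ≡ true
n<ᵇ1+n zero    = refl
n<ᵇ1+n (suc n) = n<ᵇ1+n n

1+n≮ᵇn : ∀ n → (suc n <ᵇ n) ≡ false
1+n≮ᵇn zero    = refl
1+n≮ᵇn (suc n) = 1+n≮ᵇn n

∧-congˡ-whenT : ∀ {c p q : Bool} → (T c → p ≡ q) → c ∧ p ≡ c ∧ q
∧-congˡ-whenT {false} _   = refl
∧-congˡ-whenT {true}  p≡q = p≡q _

module _ {r k : ℕ} (blk : Fin r → Fin k) (β : Fin k → Bool) where

  countIn-++ : ∀ l xs ys → countIn blk β l (xs ++ ys) ≡ countIn blk β l xs + countIn blk β l ys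
  countIn-++ l []       ys = refl
  countIn-++ l (x ∷ xs) ys rewrite countIn-++ l xs ys with toℕ (blk x) ≡ᵇ toℕ l
  ... | true  = refl
  ... | false = refl

  countIn-∷-self : ∀ {x l} xs → blk x ≡ l → countIn blk β l (x ∷ xs) ≡ suc (countIn blk β l xs)
  countIn-∷-self {l = l} xs refl rewrite ≡ᵇ-refl (toℕ l) = refl

  countIn-∷ʳ-self : ∀ {x l} xs → blk x ≡ l → countIn blk β l (xs ++ [ x ]) ≡ suc (countIn blk β l xs)
  countIn-∷ʳ-self {x} {l} xs x∈l = begin
    countIn blk β l (xs ++ [ x ])              ≡⟨ countIn-++ l xs [ x ] ⟩
    countIn blk β l xs + countIn blk β l [ x ] ≡⟨ cong (countIn blk β l xs +_) (countIn-∷-self [] x∈l) ⟩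
    countIn blk β l xs + 1                     ≡⟨ +-comm (countIn blk β l xs) 1 ⟩
    suc (countIn blk β l xs)                   ∎
    where open ≡-Reasoning

  rankIn : Fin k → List (Fin r) → List (Fin r) → ℕ
  rankIn l pre rest = suc (if β l then countIn blk β l rest else countIn blk β l pre)

  rankIn-adjacent : ∀ {l} pre x y rest → blk x ≡ l → blk y ≡ l →
    (rankIn l (pre ++ [ x ]) rest <ᵇ rankIn l pre (y ∷ rest)) ≡ β l
  rankIn-adjacent {l} pre x y rest x∈l y∈l with β l
  ... | true  = trans (cong (countIn blk β l rest <ᵇ_) (countIn-∷-self rest y∈l))
                      (n<ᵇ1+n (countIn blk β l rest))
  ... | false = trans (cong (_<ᵇ countIn blk β l pre) (countIn-∷ʳ-self pre x∈l))
                      (1+n≮ᵇn (countIn blk β l pre))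

  module _ (b : Fin k → Fin r) (blk∘b≗id : ∀ l → blk (b l) ≡ l) where

    inU≡>ᵖ-ranked : ∀ pre x y rest → inU blk β x y ≡
      _>ᵖ_ blk β (b (blk x) , rankIn (blk x) pre (y ∷ rest)) (b (blk y) , rankIn (blk y) (pre ++ [ x ]) rest)
    inU≡>ᵖ-ranked pre x y rest rewrite blk∘b≗id (blk x) | blk∘b≗id (blk y) =
      cong (_ ∨_) (∧-congˡ-whenT λ sameᵇ → sym (sameBlock (toℕ-injective (≡ᵇ⇒≡ _ _ sameᵇ))))
      where
      open ≡-Reasoning
      sameBlock : blk x ≡ blk y → (rankIn (blk y) (pre ++ [ x ]) rest <ᵇ rankIn (blk x) pre (y ∷ rest)) ≡ β (blk x)
      sameBlock x~y = begin
        rankIn (blk y) (pre ++ [ x ]) rest <ᵇ rankIn (blk x) pre (y ∷ rest)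
          ≡⟨ cong (λ l → rankIn l (pre ++ [ x ]) rest <ᵇ rankIn (blk x) pre (y ∷ rest)) (sym x~y) ⟩
        rankIn (blk x) (pre ++ [ x ]) rest <ᵇ rankIn (blk x) pre (y ∷ rest)
          ≡⟨ rankIn-adjacent pre x y rest refl (sym x~y) ⟩
        β (blk x) ∎

    majFrom-inU≡majFrom-wUFrom : ∀ n pre w →
      majFrom (inU blk β) n w ≡ majFrom (_>ᵖ_ blk β) n (wUFrom blk β b pre w)
    majFrom-inU≡majFrom-wUFrom n pre []        = refl
    majFrom-inU≡majFrom-wUFrom n pre (x ∷ []) = refl
    majFrom-inU≡majFrom-wUFrom n pre (x ∷ y ∷ rest) =
      cong₂ _+_ (cong (λ c → if c then n else 0) (inU≡>ᵖ-ranked pre x y rest))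
                (majFrom-inU≡majFrom-wUFrom (suc n) (pre ++ [ x ]) (y ∷ rest))

lemma5p2 : (r k : ℕ) → 1 ≤ r
    → (blk : Fin r → Fin k) → (β : Fin k → Bool)
    → (b : Fin k → Fin r)
    → (∀ l → blk (b l) ≡ l)
    → (∀ l (x : Fin r) → blk x ≡ l → b l ≤ᶠ x)
    → (w : List (Fin r))
    → maj'U blk β w ≡ majP blk β (wU blk β b w)
lemma5p2 r k _ blk β b blk∘b≗id _ w = majFrom-inU≡majFrom-wUFrom blk β b blk∘b≗id 1 [] w
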